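{- For all $n\ge3$, $$\mathscr{P}_{n+1}(z)=\mathscr{P}_{n}(z)+8z^2\mathscr{P}_{n-1}(z)+2^{n-1}z^2\mathscr{O}_{n-1}(z),$$ and $\mathscr{P}_2(z)=z^2+1$, $\mathscr{P}_3(z)=7z^2+1$, $\mathscr{P}_4(z)=12z^4+19z^2+1$.
   Context: For $m\ge1$, $Y=(y_1,\dots,y_{m-1})\in GF(2)^{m-1}$, let $M_m^{0,Y}$ be the symmetric tridiagonal $m\times m$ matrix over $GF(2)$ with zero diagonal and $(j,j+1)$, $(j+1,j)$ entries equal to $y_j$; $\mathscr{O}_m(z)=\sum_j O_m(j)z^j$ where $O_m(j)$ is the number of $Y$ with $\operatorname{rank}M_m^{0,Y}=j$. For $n\ge 1$, $Y=(y_1,\dots,y_{n-1})\in GF(2)^{n-1}$, $Z=(z_1,\dots,z_n)\in GF(2)^n$, let $M_{n+1}^{0,Y,Z}$ be the symmetric $(n+1)\times(n+1)$ matrix over $GF(2)$ with rows/columns indexed $0,\dots,n$, zero diagonal, $(0,k)$ and $(k,0)$ entries $z_k$ ($1\le k\le n$), $(j,j+1)$ and $(j+1,j)$ entries $y_j$ ($1\le j\le n-1$), and all other entries $0$. Then $\mathscr{P}_{n+1}(z)=\sum_j D_{n+1}(j)z^j$, where $D_{n+1}(j)$ is the number of pairs $(Y,Z)$ with $\operatorname{rank}M_{n+1}^{0,Y,Z}=j$. -}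

module Defs where

open import Data.Bool using (Bool; true; false; _xor_; _∧_; _∨_; not; if_then_else_)
open import Data.Nat using (ℕ; zero; suc; _+_; _*_; _⊔_; _≡ᵇ_; pred)
open import Data.Fin using (Fin; toℕ)
open import Data.List using (List; []; _∷_; map; concatMap; length; filter; foldr; allFin)
open import Data.Vec using (Vec; []; _∷_)
open import Data.Product using (_×_; _,_; proj₁; proj₂)
open import Data.List using (cartesianProduct)
open import Relation.Nullary.Decidable using (does)
open import Data.Bool.Properties using (T?)
open import Data.Bool using (T)

-- GF(2) is modelled by Bool with addition _xor_ and multiplication _∧_.

Matrix : ℕ → Set
Matrix m = Fin m → Fin m → Bool

-- all vectors in GF(2)^k (also used for subsets of Fin k)
allVecs : (k : ℕ) → List (Vec Bool k)
allVecs zero = [] ∷ []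
allVecs (suc k) = concatMap (λ v → (false ∷ v) ∷ (true ∷ v) ∷ []) (allVecs k)

vlookup : ∀ {k} → Vec Bool k → Fin k → Bool
vlookup (x ∷ _) Fin.zero = x
vlookup (_ ∷ v) (Fin.suc i) = vlookup v i

-- lookup by a natural-number index, false when out of range
lookupℕ : ∀ {k} → Vec Bool k → ℕ → Bool
lookupℕ [] _ = false
lookupℕ (x ∷ _) zero = x
lookupℕ (_ ∷ v) (suc i) = lookupℕ v i

card : ∀ {k} → Vec Bool k → ℕ
card [] = 0
card (true ∷ v) = suc (card v)
card (false ∷ v) = card v

rowSum : ∀ {m} → Matrix m → Vec Bool m → Fin m → Bool
rowSum {m} M T c = foldr (λ i acc → (vlookup T i ∧ M i c) xor acc) false (allFin m)

isNonzero : ∀ {m} → (Fin m → Bool) → Bool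
isNonzero {m} v = foldr (λ i acc → v i ∨ acc) false (allFin m)

subsetOf : ∀ {k} → Vec Bool k → Vec Bool k → Bool
subsetOf [] [] = true
subsetOf (t ∷ T) (s ∷ S) = ((not t) ∨ s) ∧ subsetOf T S

allB : ∀ {A : Set} → (A → Bool) → List A → Bool
allB p = foldr (λ x acc → p x ∧ acc) true

independent : ∀ {m} → Matrix m → Vec Bool m → Bool
independent {m} M S =
  allB (λ T → not (subsetOf T S) ∨ (card T ≡ᵇ 0) ∨ isNonzero (rowSum M T)) (allVecs m)

maxL : List ℕ → ℕ
maxL = foldr _⊔_ 0

rank : ∀ {m} → Matrix m → ℕ
rank {m} M = maxL (map card (filter (λ S → T? (independent M S)) (allVecs m)))

count : ∀ {A : Set} → (A → Bool) → List A → ℕ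
count p xs = length (filter (λ x → T? (p x)) xs)

-- M_{k+1}^{0,Y}, Y = (y_1..y_k) stored 0-indexed; rows/cols 0..k
triMatrix : (k : ℕ) → Vec Bool k → Matrix (suc k)
triMatrix k Y i j =
  if toℕ j ≡ᵇ suc (toℕ i) then lookupℕ Y (toℕ i)
  else if toℕ i ≡ᵇ suc (toℕ j) then lookupℕ Y (toℕ j)
  else false

-- M_{k+2}^{0,Y,Z}: rows/cols 0..k+1; row/col 0 bordered by Z = (z_1..z_{k+1});
-- the block on indices 1..k+1 is the tridiagonal matrix with Y
borderMatrix : (k : ℕ) → Vec Bool k → Vec Bool (suc k) → Matrix (suc (suc k))
borderMatrix k Y Z Fin.zero Fin.zero = false
borderMatrix k Y Z Fin.zero (Fin.suc b) = vlookup Z b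
borderMatrix k Y Z (Fin.suc a) Fin.zero = vlookup Z a
borderMatrix k Y Z (Fin.suc a) (Fin.suc b) = triMatrix k Y a b

-- Polynomials with ℕ coefficients are represented by coefficient functions ℕ → ℕ
Poly : Set
Poly = ℕ → ℕ

-- 𝒪_m(z), m ≥ 1 (value for m = 0 is an unused dummy 0)
𝒪 : ℕ → Poly
𝒪 zero j = 0
𝒪 (suc k) j = count (λ Y → rank (triMatrix k Y) ≡ᵇ j) (allVecs k)

-- 𝒫_{n+1}(z), n ≥ 1, i.e. 𝒫_m for m ≥ 2 (values for m = 0,1 are unused dummies 0)
𝒫 : ℕ → Poly
𝒫 zero j = 0
𝒫 (suc zero) j = 0
𝒫 (suc (suc k)) j =
  count (λ YZ → rank (borderMatrix k (proj₁ YZ) (proj₂ YZ)) ≡ᵇ j)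
        (cartesianProduct (allVecs k) (allVecs (suc k)))

_⊕_ : Poly → Poly → Poly
(p ⊕ q) j = p j + q j
infixl 6 _⊕_

_·_ : ℕ → Poly → Poly
(c · p) j = c * p j
infixl 7 _·_

z²· : Poly → Poly
z²· p zero = 0
z²· p (suc zero) = 0
z²· p (suc (suc j)) = p j

fromCoeffs : List ℕ → Poly
fromCoeffs [] j = 0
fromCoeffs (a ∷ as) zero = a
fromCoeffs (a ∷ as) (suc j) = fromCoeffs as j

module Submission where

-- Two pivots on a "hyperbolic pair" p, q (M p q = M q p = 1,
-- M p p = M q q = 0) lower the rank by two and leave a Schur complement.
-- Splitting the pairs (Y, Z) counted by 𝒫_{n+1} by the first link y₁ and
-- border entry z₁, the four cases reduce to: 𝒫_n (y₁ = z₁ = 0, index 1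
-- isolated); 2^{n-1} copies of z²𝒪_{n-1} (y₁ = 0, z₁ = 1); and twice four
-- copies of z²𝒫_{n-1} (y₁ = 1, pair (1,2)), where for z₁ = 1 the Schur
-- complement translates the border entry z₃ by y₂, which the sum absorbs.

open import Defs
open import Data.Nat using (ℕ; suc; _≤_; _∸_; _^_)
open import Data.List using (List; []; _∷_)
open import Data.Product using (_×_)
open import Relation.Binary.PropositionalEquality using (_≡_)

open import Data.Bool using (Bool; true; false; _xor_; _∧_; _∨_; not; if_then_else_)
open import Data.Bool.Properties
  using (T?; ∧-zeroʳ; ∧-identityʳ; ∧-assoc; ∨-zeroʳ; ∨-identityʳ;
         xor-identityʳ; xor-same; xor-comm; xor-assoc; ∧-distribˡ-xor; ∧-distribʳ-xor; if-eta)
open import Data.Nat using (zero; _+_; _*_; _⊔_; _≡ᵇ_; z≤n; s≤s)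
open import Data.Nat.Properties
  using (≤-refl; ≤-trans; ≤-antisym; m≤m⊔n; m≤n⊔m; ⊔-sel; n≤1+n;
         +-suc; +-comm; +-assoc; +-identityʳ; *-zeroʳ; *-distribˡ-+)
open import Data.Nat.Tactic.RingSolver using (solve-∀)
open import Data.Fin using (Fin; toℕ; punchIn)
open import Data.Fin.Patterns using (0F; 1F; 2F)
open import Data.List using (map; filter; foldr; tabulate; concatMap; _++_; cartesianProduct)
open import Data.List.Membership.Propositional using (_∈_)
open import Data.List.Membership.Propositional.Properties using (∈-concatMap⁺)
open import Data.List.Relation.Unary.Any using (here; there)
import Data.List.Relation.Unary.Any as Any
open import Data.Vec using (Vec; []; _∷_)
open import Data.Product using (Σ; _,_; proj₁; proj₂)
open import Data.Sum using (_⊎_; inj₁; inj₂)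
open import Data.Empty using (⊥; ⊥-elim)
open import Function using (_∘_)
open import Relation.Binary.PropositionalEquality
  using (refl; sym; trans; cong; cong₂; subst; module ≡-Reasoning)

false≢true : false ≡ true → ⊥
false≢true ()

xor-cancel : ∀ {a b} → a xor b ≡ false → a ≡ b
xor-cancel {false} {false} _ = refl
xor-cancel {true}  {true}  _ = refl

-- Boolean equality of indices; it computes on constructors, so that the
-- bookkeeping with concrete indices later on is mostly definitional.
_==_ : ∀ {m} → Fin m → Fin m → Bool
0F        == 0F        = true
0F        == Fin.suc _ = false
Fin.suc _ == 0F        = false
Fin.suc a == Fin.suc b = a == b

==-refl : ∀ {m} (a : Fin m) → (a == a) ≡ true
==-refl 0F          = refl
==-refl (Fin.suc a) = ==-refl a

==-sound : ∀ {m} (a b : Fin m) → (a == b) ≡ true → a ≡ b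
==-sound 0F          0F          _ = refl
==-sound (Fin.suc a) (Fin.suc b) e = cong Fin.suc (==-sound a b e)

==-cases : ∀ {m} (a b : Fin m) → (a == b) ≡ true ⊎ (a == b) ≡ false
==-cases a b with a == b
... | true  = inj₁ refl
... | false = inj₂ refl

punchIn-==-pivot : ∀ {m} (k : Fin (suc m)) (a : Fin m) → (punchIn k a == k) ≡ false
punchIn-==-pivot 0F          a           = refl
punchIn-==-pivot (Fin.suc k) 0F          = refl
punchIn-==-pivot (Fin.suc k) (Fin.suc a) = punchIn-==-pivot k a

punchIn-==-punchIn : ∀ {m} (k : Fin (suc m)) (a b : Fin m) → (punchIn k a == punchIn k b) ≡ (a == b)
punchIn-==-punchIn 0F          a           b           = refl
punchIn-==-punchIn (Fin.suc k) 0F          0F          = refl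
punchIn-==-punchIn (Fin.suc k) 0F          (Fin.suc b) = refl
punchIn-==-punchIn (Fin.suc k) (Fin.suc a) 0F          = refl
punchIn-==-punchIn (Fin.suc k) (Fin.suc a) (Fin.suc b) = punchIn-==-punchIn k a b

punchIn-cover : ∀ {m} (k c : Fin (suc m)) → (c == k) ≡ true ⊎ Σ (Fin m) (λ c' → punchIn k c' ≡ c)
punchIn-cover 0F 0F = inj₁ refl
punchIn-cover 0F (Fin.suc c) = inj₂ (c , refl)
punchIn-cover {suc m} (Fin.suc k) 0F = inj₂ (0F , refl)
punchIn-cover {suc m} (Fin.suc k) (Fin.suc c) with punchIn-cover k c
... | inj₁ e = inj₁ e
... | inj₂ (c' , e) = inj₂ (Fin.suc c' , cong Fin.suc e)

⨁ : ∀ {m} → (Fin m → Bool) → Bool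
⨁ {zero}  f = false
⨁ {suc m} f = f 0F xor ⨁ (λ i → f (Fin.suc i))

⨁-ext : ∀ {m} (f g : Fin m → Bool) → (∀ i → f i ≡ g i) → ⨁ f ≡ ⨁ g
⨁-ext {zero}  f g e = refl
⨁-ext {suc m} f g e = cong₂ _xor_ (e 0F) (⨁-ext _ _ (λ i → e (Fin.suc i)))

xor-interchange : ∀ a b c d → (a xor b) xor (c xor d) ≡ (a xor c) xor (b xor d)
xor-interchange a b c d = begin
  (a xor b) xor (c xor d)  ≡⟨ xor-assoc a b (c xor d) ⟩
  a xor (b xor (c xor d))  ≡⟨ cong (a xor_) (sym (xor-assoc b c d)) ⟩
  a xor ((b xor c) xor d)  ≡⟨ cong (λ x → a xor (x xor d)) (xor-comm b c) ⟩
  a xor ((c xor b) xor d)  ≡⟨ cong (a xor_) (xor-assoc c b d) ⟩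
  a xor (c xor (b xor d))  ≡⟨ sym (xor-assoc a c (b xor d)) ⟩
  (a xor c) xor (b xor d)  ∎
  where open ≡-Reasoning

⨁-xor : ∀ {m} (f g : Fin m → Bool) → ⨁ (λ i → f i xor g i) ≡ ⨁ f xor ⨁ g
⨁-xor {zero}  f g = refl
⨁-xor {suc m} f g =
  trans (cong ((f 0F xor g 0F) xor_) (⨁-xor (λ i → f (Fin.suc i)) (λ i → g (Fin.suc i))))
        (xor-interchange (f 0F) (g 0F) _ _)

⨁-∧ : ∀ {m} (f : Fin m → Bool) (c : Bool) → ⨁ (λ i → f i ∧ c) ≡ ⨁ f ∧ c
⨁-∧ {zero}  f c = refl
⨁-∧ {suc m} f c =
  trans (cong ((f 0F ∧ c) xor_) (⨁-∧ (λ i → f (Fin.suc i)) c))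
        (sym (∧-distribʳ-xor c (f 0F) _))

⨁-zero : ∀ {m} (f : Fin m → Bool) → (∀ i → f i ≡ false) → ⨁ f ≡ false
⨁-zero {zero}  f e = refl
⨁-zero {suc m} f e = cong₂ _xor_ (e 0F) (⨁-zero _ (λ i → e (Fin.suc i)))

⨁-punch : ∀ {m} (k : Fin (suc m)) (f : Fin (suc m) → Bool) → ⨁ f ≡ f k xor ⨁ (λ a → f (punchIn k a))
⨁-punch 0F f = refl
⨁-punch {suc m} (Fin.suc k) f = begin
  f 0F xor ⨁ (λ i → f (Fin.suc i))
    ≡⟨ cong (f 0F xor_) (⨁-punch k (λ i → f (Fin.suc i))) ⟩
  f 0F xor (f (Fin.suc k) xor rest)
    ≡⟨ sym (xor-assoc (f 0F) _ rest) ⟩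
  (f 0F xor f (Fin.suc k)) xor rest
    ≡⟨ cong (_xor rest) (xor-comm (f 0F) _) ⟩
  (f (Fin.suc k) xor f 0F) xor rest
    ≡⟨ xor-assoc (f (Fin.suc k)) _ rest ⟩
  f (Fin.suc k) xor (f 0F xor rest) ∎
  where
  open ≡-Reasoning
  rest = ⨁ (λ a → f (Fin.suc (punchIn k a)))

⨁-single : ∀ {m} (p : Fin m) (f : Fin m → Bool) → (∀ i → (i == p) ≡ false → f i ≡ false) → ⨁ f ≡ f p
⨁-single {suc m} p f e = begin
  ⨁ f                                 ≡⟨ ⨁-punch p f ⟩
  f p xor ⨁ (λ a → f (punchIn p a))   ≡⟨ cong (f p xor_) (⨁-zero _ (λ a → e _ (punchIn-==-pivot p a))) ⟩
  f p xor false                       ≡⟨ xor-identityʳ (f p) ⟩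
  f p                                 ∎
  where open ≡-Reasoning

⨁-true : ∀ {m} (f : Fin m → Bool) → ⨁ f ≡ true → Σ (Fin m) (λ i → f i ≡ true)
⨁-true {suc m} f e with f 0F in e0
... | true  = 0F , e0
... | false with ⨁-true (λ i → f (Fin.suc i)) e
...   | i , ei = Fin.suc i , ei

foldr-xor-⨁ : ∀ {m} {A : Set} (f : A → Bool) (h : Fin m → A) →
  foldr (λ i acc → f i xor acc) false (tabulate h) ≡ ⨁ (λ i → f (h i))
foldr-xor-⨁ {zero}  f h = refl
foldr-xor-⨁ {suc m} f h = cong (f (h 0F) xor_) (foldr-xor-⨁ f (λ i → h (Fin.suc i)))

isNonzero-false : ∀ {m} {A : Set} (f : A → Bool) (h : Fin m → A) →
  foldr (λ i acc → f i ∨ acc) false (tabulate h) ≡ false → ∀ i → f (h i) ≡ false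
isNonzero-false {suc m} f h e i with f (h 0F) in e0
isNonzero-false {suc m} f h e 0F          | false = e0
isNonzero-false {suc m} f h e (Fin.suc i) | false = isNonzero-false f (λ i → h (Fin.suc i)) e i

isNonzero-zero : ∀ {m} {A : Set} (f : A → Bool) (h : Fin m → A) →
  (∀ i → f (h i) ≡ false) → foldr (λ i acc → f i ∨ acc) false (tabulate h) ≡ false
isNonzero-zero {zero}  f h e = refl
isNonzero-zero {suc m} f h e = cong₂ _∨_ (e 0F) (isNonzero-zero f (λ i → h (Fin.suc i)) (λ i → e (Fin.suc i)))

fromFun : ∀ {m} → (Fin m → Bool) → Vec Bool m
fromFun {zero}  f = []
fromFun {suc m} f = f 0F ∷ fromFun (λ i → f (Fin.suc i))

vlookup-fromFun : ∀ {m} (f : Fin m → Bool) i → vlookup (fromFun f) i ≡ f i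
vlookup-fromFun f 0F          = refl
vlookup-fromFun f (Fin.suc i) = vlookup-fromFun (λ i → f (Fin.suc i)) i

vec-ext : ∀ {m} (u v : Vec Bool m) → (∀ i → vlookup u i ≡ vlookup v i) → u ≡ v
vec-ext []      []      e = refl
vec-ext (x ∷ u) (y ∷ v) e = cong₂ _∷_ (e 0F) (vec-ext u v (λ i → e (Fin.suc i)))

card-fromFun-ext : ∀ {m} (f g : Fin m → Bool) → (∀ i → f i ≡ g i) → card (fromFun f) ≡ card (fromFun g)
card-fromFun-ext f g e = cong card (vec-ext (fromFun f) (fromFun g)
  (λ i → trans (vlookup-fromFun f i) (trans (e i) (sym (vlookup-fromFun g i)))))

card-fromFun-vlookup : ∀ {m} (S : Vec Bool m) → card (fromFun (vlookup S)) ≡ card S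
card-fromFun-vlookup S = cong card (vec-ext (fromFun (vlookup S)) S (vlookup-fromFun (vlookup S)))

bit : Bool → ℕ
bit true  = 1
bit false = 0

card-punch : ∀ {m} (k : Fin (suc m)) (S : Vec Bool (suc m)) {b} → vlookup S k ≡ b →
  card S ≡ bit b + card (fromFun (λ a → vlookup S (punchIn k a)))
card-punch 0F (true  ∷ S) refl = cong suc (sym (card-fromFun-vlookup S))
card-punch 0F (false ∷ S) refl = sym (card-fromFun-vlookup S)
card-punch {suc m} (Fin.suc k) (true  ∷ S) e = trans (cong suc (card-punch k S e)) (sym (+-suc _ _))
card-punch {suc m} (Fin.suc k) (false ∷ S) e = card-punch k S e

card-nonempty : ∀ {m} (S : Vec Bool m) i → vlookup S i ≡ true → (card S ≡ᵇ 0) ≡ false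
card-nonempty (true  ∷ S) i           e = refl
card-nonempty (false ∷ S) (Fin.suc i) e = card-nonempty S i e

card-witness : ∀ {m} (S : Vec Bool m) → (card S ≡ᵇ 0) ≡ false → Σ (Fin m) (λ i → vlookup S i ≡ true)
card-witness (true ∷ S) e = 0F , refl
card-witness (false ∷ S) e with card-witness S e
... | i , ei = Fin.suc i , ei

card-empty : ∀ {m} → card (fromFun {m} (λ _ → false)) ≡ 0
card-empty {zero}  = refl
card-empty {suc m} = card-empty {m}

_+ₛ_ : ∀ {m} → (Fin m → Bool) → Fin m → Fin m → Bool
(s +ₛ p) i = s i ∨ (i == p)

_-ₛ_ : ∀ {m} → (Fin m → Bool) → Fin m → Fin m → Bool
(s -ₛ p) i = s i ∧ not (i == p)

_⊆_ : ∀ {m} → (Fin m → Bool) → (Fin m → Bool) → Set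
s ⊆ s' = ∀ i → s i ≡ true → s' i ≡ true

-ₛ-⊆ : ∀ {m} (s : Fin m → Bool) (p : Fin m) → (s -ₛ p) ⊆ s
-ₛ-⊆ s p i e with s i
... | true = refl

-ₛ-other : ∀ {m} (s : Fin m → Bool) (p : Fin m) i → (s -ₛ p) i ≡ true → (i == p) ≡ false
-ₛ-other s p i e with s i | i == p
... | true | false = refl

+ₛ-self : ∀ {m} (s : Fin m → Bool) (p : Fin m) → vlookup (fromFun (s +ₛ p)) p ≡ true
+ₛ-self s p = trans (vlookup-fromFun (s +ₛ p) p) (trans (cong (s p ∨_) (==-refl p)) (∨-zeroʳ _))

card-+ₛ : ∀ {m} (S : Vec Bool m) (p : Fin m) → vlookup S p ≡ false →
  card (fromFun (vlookup S +ₛ p)) ≡ suc (card S)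
card-+ₛ {suc m} S p e = begin
  card S⁺
    ≡⟨ card-punch p S⁺ (+ₛ-self (vlookup S) p) ⟩
  suc (card (fromFun (λ a → vlookup S⁺ (punchIn p a))))
    ≡⟨ cong suc (card-fromFun-ext _ _ off-p) ⟩
  suc (card (fromFun (λ a → vlookup S (punchIn p a))))
    ≡⟨ cong suc (sym (card-punch p S e)) ⟩
  suc (card S) ∎
  where
  open ≡-Reasoning
  S⁺ = fromFun (vlookup S +ₛ p)
  off-p : ∀ a → vlookup S⁺ (punchIn p a) ≡ vlookup S (punchIn p a)
  off-p a = trans (vlookup-fromFun (vlookup S +ₛ p) (punchIn p a))
    (trans (cong (vlookup S (punchIn p a) ∨_) (punchIn-==-pivot p a)) (∨-identityʳ _))

-ₛ-self : ∀ {m} (p : Fin m) (s : Fin m → Bool) → (s -ₛ p) p ≡ false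
-ₛ-self p s = trans (cong (λ b → s p ∧ not b) (==-refl p)) (∧-zeroʳ (s p))

card--ₛ : ∀ {m} (S : Vec Bool m) (p : Fin m) → vlookup S p ≡ true →
  card S ≡ suc (card (fromFun (vlookup S -ₛ p)))
card--ₛ {suc m} S p e = begin
  card S
    ≡⟨ card-punch p S e ⟩
  suc (card (fromFun (λ a → vlookup S (punchIn p a))))
    ≡⟨ cong suc (card-fromFun-ext _ _ off-p) ⟩
  suc (card (fromFun (λ a → vlookup S⁻ (punchIn p a))))
    ≡⟨ cong suc (sym (card-punch p S⁻ at-p)) ⟩
  suc (card S⁻) ∎
  where
  open ≡-Reasoning
  S⁻ = fromFun (vlookup S -ₛ p)
  at-p : vlookup S⁻ p ≡ false
  at-p = trans (vlookup-fromFun (vlookup S -ₛ p) p) (-ₛ-self p (vlookup S))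
  off-p : ∀ a → vlookup S (punchIn p a) ≡ vlookup S⁻ (punchIn p a)
  off-p a = sym (trans (vlookup-fromFun (vlookup S -ₛ p) (punchIn p a))
    (trans (cong (λ b → vlookup S (punchIn p a) ∧ not b) (punchIn-==-pivot p a)) (∧-identityʳ _)))

subsetOf-sound : ∀ {m} (T S : Vec Bool m) → subsetOf T S ≡ true → ∀ i → vlookup T i ≡ true → vlookup S i ≡ true
subsetOf-sound (true ∷ T) (true  ∷ S) e 0F _ = refl
subsetOf-sound (t    ∷ T) (s     ∷ S) e (Fin.suc i) ti with t | s
... | false | _    = subsetOf-sound T S e i ti
... | true  | true = subsetOf-sound T S e i ti

subsetOf-complete : ∀ {m} (T S : Vec Bool m) → (∀ i → vlookup T i ≡ true → vlookup S i ≡ true) → subsetOf T S ≡ true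
subsetOf-complete []          []      h = refl
subsetOf-complete (false ∷ T) (s ∷ S) h = subsetOf-complete T S (λ i → h (Fin.suc i))
subsetOf-complete (true  ∷ T) (s ∷ S) h rewrite h 0F refl = subsetOf-complete T S (λ i → h (Fin.suc i))

allVecs-complete : ∀ {k} (v : Vec Bool k) → v ∈ allVecs k
allVecs-complete []      = here refl
allVecs-complete (b ∷ v) =
  ∈-concatMap⁺ (λ u → (false ∷ u) ∷ (true ∷ u) ∷ []) (Any.map (λ { refl → choose b }) (allVecs-complete v))
  where
  choose : ∀ b → (b ∷ v) ∈ ((false ∷ v) ∷ (true ∷ v) ∷ [])
  choose false = here refl
  choose true  = there (here refl)

allB-true : ∀ {A : Set} (p : A → Bool) {x} {xs} → allB p xs ≡ true → x ∈ xs → p x ≡ true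
allB-true p {xs = y ∷ xs} e (here refl) with p y
... | true = refl
allB-true p {xs = y ∷ xs} e (there i) with p y
... | true = allB-true p e i

allB-false : ∀ {A : Set} (p : A → Bool) xs → allB p xs ≡ false → Σ A (λ x → p x ≡ false)
allB-false p (x ∷ xs) e with p x in ex
... | false = x , ex
... | true  = allB-false p xs e

maxL-upper : ∀ {A : Set} (p : A → Bool) (c : A → ℕ) {x} {xs} → x ∈ xs → p x ≡ true →
  c x ≤ maxL (map c (filter (λ y → T? (p y)) xs))
maxL-upper p c {x} {y ∷ xs} (here refl) px rewrite px = m≤m⊔n (c x) _
maxL-upper p c {x} {y ∷ xs} (there i) px with p y
... | false = maxL-upper p c i px
... | true  = ≤-trans (maxL-upper p c i px) (m≤n⊔m (c y) _)

maxL-attained : ∀ {A : Set} (p : A → Bool) (c : A → ℕ) xs →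
  let μ = maxL (map c (filter (λ y → T? (p y)) xs)) in
  (μ ≡ 0) ⊎ Σ A (λ x → (p x ≡ true) × (c x ≡ μ))
maxL-attained p c [] = inj₁ refl
maxL-attained p c (y ∷ xs) with p y in ey
... | false = maxL-attained p c xs
... | true with ⊔-sel (c y) (maxL (map c (filter (λ y → T? (p y)) xs)))
...   | inj₁ e = inj₂ (y , ey , sym e)
...   | inj₂ e with maxL-attained p c xs
...     | inj₁ e0 = inj₁ (trans e e0)
...     | inj₂ (x , px , cx) = inj₂ (x , px , trans cx (sym e))

-- Linear (in)dependence and rank.

rowComb : ∀ {m} → Matrix m → (Fin m → Bool) → Fin m → Bool
rowComb M t c = ⨁ (λ i → t i ∧ M i c)

rowSum-rowComb : ∀ {m} (M : Matrix m) (T : Vec Bool m) c → rowSum M T c ≡ rowComb M (vlookup T) c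
rowSum-rowComb M T c = foldr-xor-⨁ (λ i → vlookup T i ∧ M i c) (λ i → i)

rowComb-ext : ∀ {m} (M : Matrix m) (t u : Fin m → Bool) → (∀ i → t i ≡ u i) → ∀ c → rowComb M t c ≡ rowComb M u c
rowComb-ext M t u e c = ⨁-ext _ _ (λ i → cong (_∧ M i c) (e i))

record Dependency {m} (M : Matrix m) (s : Fin m → Bool) : Set where
  constructor dependency
  field
    t        : Fin m → Bool
    t⊆s      : t ⊆ s
    nonempty : Σ (Fin m) (λ i → t i ≡ true)
    sum-zero : ∀ c → rowComb M t c ≡ false

independent-false : ∀ {m} (M : Matrix m) (S : Vec Bool m) → independent M S ≡ false → Dependency M (vlookup S)
independent-false {m} M S e with allB-false _ (allVecs m) e
... | T , eT with not (subsetOf T S) in e1 | card T ≡ᵇ 0 in e2 | isNonzero (rowSum M T) in e3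
...   | false | false | false = dependency (vlookup T) (subsetOf-sound T S (not-false e1)) (card-witness T e2)
          (λ c → trans (sym (rowSum-rowComb M T c)) (isNonzero-false (rowSum M T) (λ i → i) e3 c))
  where
  not-false : ∀ {a} → not a ≡ false → a ≡ true
  not-false {true} _ = refl
independent-false {m} M S e | T , () | false | false | true
independent-false {m} M S e | T , () | false | true  | _
independent-false {m} M S e | T , () | true  | _     | _

independent-true : ∀ {m} (M : Matrix m) (S : Vec Bool m) → independent M S ≡ true → Dependency M (vlookup S) → ⊥
independent-true {m} M S e (dependency t t⊆s (i , ti) zero-sum) =
  false≢true (trans (sym T-refutes) (allB-true _ e (allVecs-complete T)))
  where
  T = fromFun t
  T-refutes : (not (subsetOf T S) ∨ (card T ≡ᵇ 0) ∨ isNonzero (rowSum M T)) ≡ false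
  T-refutes rewrite subsetOf-complete T S (λ j ej → t⊆s j (trans (sym (vlookup-fromFun t j)) ej))
                  | card-nonempty T i (trans (vlookup-fromFun t i) ti)
    = isNonzero-zero (rowSum M T) (λ i → i)
        (λ c → trans (rowSum-rowComb M T c) (trans (rowComb-ext M _ _ (vlookup-fromFun t) c) (zero-sum c)))

independent-intro : ∀ {m} (M : Matrix m) (S : Vec Bool m) → (Dependency M (vlookup S) → ⊥) → independent M S ≡ true
independent-intro M S h with independent M S in e
... | true  = refl
... | false = ⊥-elim (h (independent-false M S e))

independent-cases : ∀ {m} (M : Matrix m) (S : Vec Bool m) → (independent M S ≡ true) ⊎ Dependency M (vlookup S)
independent-cases M S with independent M S in e
... | true  = inj₁ refl
... | false = inj₂ (independent-false M S e)

rank-upper : ∀ {m} (M : Matrix m) (S : Vec Bool m) → independent M S ≡ true → card S ≤ rank M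
rank-upper {m} M S e = maxL-upper (independent M) card (allVecs-complete S) e

rank-attained : ∀ {m} (M : Matrix m) → Σ (Vec Bool m) (λ S → (independent M S ≡ true) × (card S ≡ rank M))
rank-attained {m} M with maxL-attained (independent M) card (allVecs m)
... | inj₂ (S , iS , cS) = S , iS , cS
... | inj₁ e0 = fromFun (λ _ → false) , independent-intro M _ no-dependency , trans (card-empty {m}) (sym e0)
  where
  no-dependency : Dependency M (vlookup (fromFun (λ _ → false))) → ⊥
  no-dependency (dependency t t⊆s (i , ti) _) = false≢true (trans (sym (vlookup-fromFun (λ _ → false) i)) (t⊆s i ti))

rank-char : ∀ {m} (M : Matrix m) (r : ℕ) →
  Σ (Vec Bool m) (λ S → (independent M S ≡ true) × (r ≤ card S)) →
  (∀ S → independent M S ≡ true → card S ≤ r) → rank M ≡ r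
rank-char M r (S , iS , r≤S) upper with rank-attained M
... | S₀ , iS₀ , cS₀ = ≤-antisym (subst (_≤ r) cS₀ (upper S₀ iS₀)) (≤-trans r≤S (rank-upper M S iS))

independent-ext : ∀ {m} (M N : Matrix m) → (∀ a b → M a b ≡ N a b) →
  ∀ S → independent M S ≡ true → independent N S ≡ true
independent-ext M N e S iS = independent-intro N S λ { (dependency t t⊆s ne zero-sum) →
  independent-true M S iS (dependency t t⊆s ne (λ c → trans (⨁-ext _ _ (λ j → cong (t j ∧_) (e j c))) (zero-sum c))) }

rank-ext : ∀ {m} (M N : Matrix m) → (∀ a b → M a b ≡ N a b) → rank M ≡ rank N
rank-ext M N e with rank-attained N
... | S , iS , cS = rank-char M (rank N) (S , independent-ext N M (λ a b → sym (e a b)) S iS , subst (_≤ card S) cS ≤-refl)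
  (λ S' iS' → rank-upper N S' (independent-ext M N e S' iS'))

single : ∀ {m} → Fin m → Bool → Fin m → Bool
single p b i = (i == p) ∧ b

single-⊆ : ∀ {m} (s : Fin m → Bool) (p : Fin m) → s p ≡ true → single p true ⊆ s
single-⊆ s p sp i ei = subst (λ j → s j ≡ true) (sym (==-sound i p (trans (sym (∧-identityʳ _)) ei))) sp

rowComb-single : ∀ {m} (M : Matrix m) (p : Fin m) (b : Bool) c → rowComb M (single p b) c ≡ b ∧ M p c
rowComb-single M p b c =
  trans (⨁-single p _ (λ i e → cong (λ x → (x ∧ b) ∧ M i c) e)) (cong (λ x → (x ∧ b) ∧ M p c) (==-refl p))

rowComb-xor : ∀ {m} (M : Matrix m) (f g : Fin m → Bool) c → rowComb M (λ i → f i xor g i) c ≡ rowComb M f c xor rowComb M g c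
rowComb-xor M f g c = trans (⨁-ext _ _ (λ i → ∧-distribʳ-xor (M i c) (f i) (g i)))
                                 (⨁-xor (λ i → f i ∧ M i c) (λ i → g i ∧ M i c))

rowComb-true : ∀ {m} (M : Matrix m) (f : Fin m → Bool) c → rowComb M f c ≡ true → Σ (Fin m) (λ i → f i ≡ true)
rowComb-true M f c e with ⨁-true _ e
... | i , ei = i , ∧-true-left ei
  where
  ∧-true-left : ∀ {a b} → a ∧ b ≡ true → a ≡ true
  ∧-true-left {true} _ = refl

rowComb-split : ∀ {m} (M : Matrix m) (p : Fin m) (t : Fin m → Bool) c →
  rowComb M t c ≡ rowComb M (t -ₛ p) c xor (t p ∧ M p c)
rowComb-split M p t c = begin
  rowComb M t c                                           ≡⟨ rowComb-ext M _ _ split c ⟩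
  rowComb M (λ i → (t -ₛ p) i xor single p (t p) i) c     ≡⟨ rowComb-xor M (t -ₛ p) (single p (t p)) c ⟩
  rowComb M (t -ₛ p) c xor rowComb M (single p (t p)) c   ≡⟨ cong (rowComb M (t -ₛ p) c xor_) (rowComb-single M p (t p) c) ⟩
  rowComb M (t -ₛ p) c xor (t p ∧ M p c)                  ∎
  where
  open ≡-Reasoning
  split : ∀ i → t i ≡ (t -ₛ p) i xor single p (t p) i
  split i with i == p in e
  ... | true  rewrite ==-sound i p e = sym (cong (_xor t p) (∧-zeroʳ (t p)))
  ... | false = sym (trans (xor-identityʳ _) (∧-identityʳ (t i)))

zero-row-excluded : ∀ {m} (M : Matrix m) (k : Fin m) → (∀ c → M k c ≡ false) →
  ∀ S → independent M S ≡ true → vlookup S k ≡ false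
zero-row-excluded M k row-zero S iS with vlookup S k in e
... | false = refl
... | true  = ⊥-elim (independent-true M S iS
      (dependency (single k true) (single-⊆ (vlookup S) k e) (k , cong (_∧ true) (==-refl k))
                  (λ c → trans (rowComb-single M k true c) (row-zero c))))

-- Pivoting.  For M p q = 1, `pivot M p q` subtracts M a q times row p from
-- every other row a, which clears column q, and replaces row p by zero.

pivot : ∀ {m} → Matrix m → Fin m → Fin m → Matrix m
pivot M p q a b = if (a == p) ∨ (b == q) then false else (M a b xor (M a q ∧ M p b))

pivot-col-q : ∀ {m} (M : Matrix m) p q a → pivot M p q a q ≡ false
pivot-col-q M p q a rewrite ==-refl q | ∨-zeroʳ (a == p) = refl

pivot-row-p : ∀ {m} (M : Matrix m) p q b → pivot M p q p b ≡ false
pivot-row-p M p q b rewrite ==-refl p = refl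

pivot-entry : ∀ {m} (M : Matrix m) p q a b → (a == p) ≡ false → (b == q) ≡ false →
  pivot M p q a b ≡ M a b xor (M a q ∧ M p b)
pivot-entry M p q a b ea eb rewrite ea | eb = refl

rowComb-pivot : ∀ {m} (M : Matrix m) p q → M p q ≡ true → (w : Fin m → Bool) → w p ≡ false →
  ∀ c → rowComb (pivot M p q) w c ≡ rowComb M w c xor (rowComb M w q ∧ M p c)
rowComb-pivot M p q Mpq w wp c with ==-cases c q
... | inj₁ ec with ==-sound c q ec
...   | refl =
  trans (⨁-zero _ (λ i → trans (cong (w i ∧_) (pivot-col-q M p q i)) (∧-zeroʳ (w i))))
        (sym (trans (cong (λ x → rowComb M w q xor (rowComb M w q ∧ x)) Mpq)
                    (trans (cong (rowComb M w q xor_) (∧-identityʳ _)) (xor-same (rowComb M w q)))))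
rowComb-pivot M p q Mpq w wp c | inj₂ ec =
  trans (⨁-ext _ _ term)
    (trans (⨁-xor (λ i → w i ∧ M i c) (λ i → (w i ∧ M i q) ∧ M p c))
           (cong (rowComb M w c xor_) (⨁-∧ (λ i → w i ∧ M i q) (M p c))))
  where
  term : ∀ i → w i ∧ pivot M p q i c ≡ (w i ∧ M i c) xor ((w i ∧ M i q) ∧ M p c)
  term i with i == p in ei
  ... | true rewrite ==-sound i p ei | wp = refl
  ... | false rewrite ec =
    trans (∧-distribˡ-xor (w i) (M i c) _) (cong ((w i ∧ M i c) xor_) (sym (∧-assoc (w i) _ _)))

pivot-extend : ∀ {m} (M : Matrix m) p q → M p q ≡ true → ∀ S' →
  independent (pivot M p q) S' ≡ true → independent M (fromFun (vlookup S' +ₛ p)) ≡ true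
pivot-extend M p q Mpq S' iS' = independent-intro M _ λ { (dependency t t⊆ (i₀ , ti₀) zero-sum) →
  independent-true (pivot M p q) S' iS' (reduced t t⊆ i₀ ti₀ zero-sum) }
  where
  reduced : ∀ t → t ⊆ vlookup (fromFun (vlookup S' +ₛ p)) → ∀ i₀ → t i₀ ≡ true →
    (∀ c → rowComb M t c ≡ false) → Dependency (pivot M p q) (vlookup S')
  reduced t t⊆ i₀ ti₀ zero-sum = dependency w w⊆ nonempty w-zero
    where
    w = t -ₛ p
    -- since t sums to zero, w sums to t p times row p
    w-sum : ∀ c → rowComb M w c ≡ t p ∧ M p c
    w-sum c = xor-cancel (trans (sym (rowComb-split M p t c)) (zero-sum c))
    w-zero : ∀ c → rowComb (pivot M p q) w c ≡ false
    w-zero c = begin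
      rowComb (pivot M p q) w c                      ≡⟨ rowComb-pivot M p q Mpq w (-ₛ-self p t) c ⟩
      rowComb M w c xor (rowComb M w q ∧ M p c)      ≡⟨ cong₂ (λ x y → x xor (y ∧ M p c)) (w-sum c) (w-sum q) ⟩
      (t p ∧ M p c) xor ((t p ∧ M p q) ∧ M p c)      ≡⟨ cong (λ x → (t p ∧ M p c) xor ((t p ∧ x) ∧ M p c)) Mpq ⟩
      (t p ∧ M p c) xor ((t p ∧ true) ∧ M p c)       ≡⟨ cong (λ x → (t p ∧ M p c) xor (x ∧ M p c)) (∧-identityʳ (t p)) ⟩
      (t p ∧ M p c) xor (t p ∧ M p c)                ≡⟨ xor-same (t p ∧ M p c) ⟩
      false                                          ∎
      where open ≡-Reasoning
    w⊆ : w ⊆ vlookup S'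
    w⊆ i wi = trans (sym (∨-identityʳ _)) (trans (cong (vlookup S' i ∨_) (sym (-ₛ-other t p i wi)))
                (trans (sym (vlookup-fromFun (vlookup S' +ₛ p) i)) (t⊆ i (-ₛ-⊆ t p i wi))))
    nonempty : Σ _ (λ i → w i ≡ true)
    nonempty with t p in etp | i₀ == p in ei
    ... | true  | _     = rowComb-true M w q (trans (w-sum q) (trans (cong (_∧ M p q) etp) Mpq))
    ... | false | false = i₀ , trans (cong (λ x → t i₀ ∧ not x) ei) (trans (∧-identityʳ _) ti₀)
    ... | false | true  = ⊥-elim (false≢true (trans (sym etp) (subst (λ j → t j ≡ true) (==-sound i₀ p ei) ti₀)))

-- The index j ∉ s' with v j = 1
-- guarantees that the combination built from τ and v is nonempty.
lift-dependency : ∀ {m} (M : Matrix m) p q → M p q ≡ true → {s s' : Fin m → Bool} →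
  s' p ≡ false → s' ⊆ s → Dependency (pivot M p q) s' →
  (v : Fin m → Bool) → v ⊆ s → (∀ c → rowComb M v c ≡ M p c) →
  (j : Fin m) → s' j ≡ false → v j ≡ true → Dependency M s
lift-dependency M p q Mpq {s} {s'} s'p s'⊆s (dependency τ τ⊆s' (i₀ , τi₀) τ-zero) v v⊆s v-row j s'j vj =
  combine (rowComb M τ q) refl
  where
  τ-outside : ∀ i → s' i ≡ false → τ i ≡ false
  τ-outside i e with τ i in eτ
  ... | false = refl
  ... | true  = ⊥-elim (false≢true (trans (sym e) (τ⊆s' i eτ)))
  τ-sum : ∀ c → rowComb M τ c ≡ rowComb M τ q ∧ M p c
  τ-sum c = xor-cancel (trans (sym (rowComb-pivot M p q Mpq τ (τ-outside p s'p) c)) (τ-zero c))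
  combine : ∀ x → rowComb M τ q ≡ x → Dependency M s
  combine false ex = dependency τ (λ i e → s'⊆s i (τ⊆s' i e)) (i₀ , τi₀)
    (λ c → trans (τ-sum c) (cong (_∧ M p c) ex))
  combine true ex = dependency (λ i → τ i xor v i) τv⊆s (j , trans (cong (_xor v j) (τ-outside j s'j)) vj) τv-zero
    where
    τv⊆s : (λ i → τ i xor v i) ⊆ s
    τv⊆s i e with τ i in eτ
    ... | true  = s'⊆s i (τ⊆s' i eτ)
    ... | false = v⊆s i e
    τv-zero : ∀ c → rowComb M (λ i → τ i xor v i) c ≡ false
    τv-zero c = begin
      rowComb M (λ i → τ i xor v i) c       ≡⟨ rowComb-xor M τ v c ⟩
      rowComb M τ c xor rowComb M v c       ≡⟨ cong₂ _xor_ (trans (τ-sum c) (cong (_∧ M p c) ex)) (v-row c) ⟩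
      M p c xor M p c                       ≡⟨ xor-same (M p c) ⟩
      false                                 ∎
      where open ≡-Reasoning

pivot-remove : ∀ {m} (M : Matrix m) p q → M p q ≡ true → ∀ S → independent M S ≡ true → vlookup S p ≡ true →
  independent (pivot M p q) (fromFun (vlookup S -ₛ p)) ≡ true
pivot-remove M p q Mpq S iS Sp = independent-intro (pivot M p q) _ λ dep →
  independent-true M S iS (lift-dependency M p q Mpq s'p s'⊆S dep
    (single p true) (single-⊆ (vlookup S) p Sp) (rowComb-single M p true) p s'p (cong (_∧ true) (==-refl p)))
  where
  s'p : vlookup (fromFun (vlookup S -ₛ p)) p ≡ false
  s'p = trans (vlookup-fromFun (vlookup S -ₛ p) p) (-ₛ-self p (vlookup S))
  s'⊆S : vlookup (fromFun (vlookup S -ₛ p)) ⊆ vlookup S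
  s'⊆S i e = -ₛ-⊆ (vlookup S) p i (trans (sym (vlookup-fromFun (vlookup S -ₛ p) i)) e)

-- Upper bound, case p ∉ S but S ∪ {p} dependent: then row p is a combination
-- of rows of S, one of which (j) can be exchanged against p.
pivot-exchange : ∀ {m} (M : Matrix m) p q → M p q ≡ true → ∀ S → independent M S ≡ true → vlookup S p ≡ false →
  Dependency M (vlookup (fromFun (vlookup S +ₛ p))) →
  Σ (Fin m) (λ j → (vlookup S j ≡ true) × (independent (pivot M p q) (fromFun (vlookup S -ₛ j)) ≡ true))
pivot-exchange M p q Mpq S iS Sp (dependency t t⊆S⁺ ne t-zero) =
  j , v⊆S j vj , independent-intro (pivot M p q) _ λ dep →
    independent-true M S iS (lift-dependency M p q Mpq s'p s'⊆S dep v v⊆S v-row j s'j vj)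
  where
  s = vlookup S
  t-off-p : ∀ i → t i ≡ true → (i == p) ≡ false → s i ≡ true
  t-off-p i ti ei = trans (sym (∨-identityʳ (s i)))
    (trans (cong (s i ∨_) (sym ei)) (trans (sym (vlookup-fromFun (s +ₛ p) i)) (t⊆S⁺ i ti)))
  tp : t p ≡ true
  tp with t p in e
  ... | true  = refl
  ... | false = ⊥-elim (independent-true M S iS (dependency t t⊆S ne t-zero))
    where
    t⊆S : t ⊆ s
    t⊆S i ti with i == p in ei
    ... | false = t-off-p i ti ei
    ... | true  = ⊥-elim (false≢true (trans (sym e) (subst (λ k → t k ≡ true) (==-sound i p ei) ti)))
  v = t -ₛ p
  v⊆S : v ⊆ s
  v⊆S i vi = t-off-p i (-ₛ-⊆ t p i vi) (-ₛ-other t p i vi)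
  v-row : ∀ c → rowComb M v c ≡ M p c
  v-row c = xor-cancel (trans (sym (trans (rowComb-split M p t c) (cong (λ x → rowComb M v c xor (x ∧ M p c)) tp))) (t-zero c))
  witness = rowComb-true M v q (trans (v-row q) Mpq)
  j = proj₁ witness
  vj = proj₂ witness
  s'p : vlookup (fromFun (s -ₛ j)) p ≡ false
  s'p = trans (vlookup-fromFun (s -ₛ j) p) (cong (_∧ not (p == j)) Sp)
  s'j : vlookup (fromFun (s -ₛ j)) j ≡ false
  s'j = trans (vlookup-fromFun (s -ₛ j) j) (-ₛ-self j s)
  s'⊆S : vlookup (fromFun (s -ₛ j)) ⊆ s
  s'⊆S i e = -ₛ-⊆ s j i (trans (sym (vlookup-fromFun (s -ₛ j) i)) e)

pivot-rank : ∀ {m} (M : Matrix m) p q → M p q ≡ true → rank M ≡ suc (rank (pivot M p q))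
pivot-rank {m} M p q Mpq = rank-char M _ lower upper
  where
  M' = pivot M p q
  lower : Σ (Vec Bool m) (λ S → (independent M S ≡ true) × (suc (rank M') ≤ card S))
  lower with rank-attained M'
  ... | S' , iS' , cS' = fromFun (vlookup S' +ₛ p) , pivot-extend M p q Mpq S' iS' ,
        subst (suc (rank M') ≤_) (sym (trans (card-+ₛ S' p p∉S') (cong suc cS'))) ≤-refl
    where p∉S' = zero-row-excluded M' p (pivot-row-p M p q) S' iS'
  containing-p : ∀ S → independent M S ≡ true → vlookup S p ≡ true → card S ≤ suc (rank M')
  containing-p S iS Sp =
    subst (_≤ suc (rank M')) (sym (card--ₛ S p Sp)) (s≤s (rank-upper M' _ (pivot-remove M p q Mpq S iS Sp)))
  upper : ∀ S → independent M S ≡ true → card S ≤ suc (rank M')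
  upper S iS with vlookup S p in Sp
  ... | true = containing-p S iS Sp
  ... | false with independent-cases M (fromFun (vlookup S +ₛ p))
  ...   | inj₁ iS⁺ = ≤-trans (n≤1+n _) (subst (_≤ suc (rank M')) (card-+ₛ S p Sp)
                       (containing-p _ iS⁺ (+ₛ-self (vlookup S) p)))
  ...   | inj₂ dep with pivot-exchange M p q Mpq S iS Sp dep
  ...     | j , Sj , iS⁻ = subst (_≤ suc (rank M')) (sym (card--ₛ S j Sj)) (s≤s (rank-upper M' _ iS⁻))

-- Deleting a zero row and column.

delete : ∀ {m} → Fin (suc m) → Matrix (suc m) → Matrix m
delete k M a b = M (punchIn k a) (punchIn k b)

-- The subset S of Fin m, transported to Fin (suc m) along punchIn k.
insertAt : ∀ {m} → Fin (suc m) → Vec Bool m → Vec Bool (suc m)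
insertAt 0F          v       = false ∷ v
insertAt (Fin.suc k) (x ∷ v) = x ∷ insertAt k v

insertAt-self : ∀ {m} k (v : Vec Bool m) → vlookup (insertAt k v) k ≡ false
insertAt-self 0F          v       = refl
insertAt-self (Fin.suc k) (x ∷ v) = insertAt-self k v

insertAt-punchIn : ∀ {m} k (v : Vec Bool m) a → vlookup (insertAt k v) (punchIn k a) ≡ vlookup v a
insertAt-punchIn 0F          v       a           = refl
insertAt-punchIn (Fin.suc k) (x ∷ v) 0F          = refl
insertAt-punchIn (Fin.suc k) (x ∷ v) (Fin.suc a) = insertAt-punchIn k v a

card-insertAt : ∀ {m} k (v : Vec Bool m) → card (insertAt k v) ≡ card v
card-insertAt k v = begin
  card (insertAt k v)
    ≡⟨ card-punch k (insertAt k v) (insertAt-self k v) ⟩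
  card (fromFun (λ a → vlookup (insertAt k v) (punchIn k a)))
    ≡⟨ card-fromFun-ext _ _ (insertAt-punchIn k v) ⟩
  card (fromFun (vlookup v))
    ≡⟨ card-fromFun-vlookup v ⟩
  card v ∎
  where open ≡-Reasoning

delete-extend : ∀ {m} (M : Matrix (suc m)) k S' → independent (delete k M) S' ≡ true → independent M (insertAt k S') ≡ true
delete-extend {m} M k S' iS' = independent-intro M _ λ { (dependency t t⊆ (i₀ , ti₀) t-zero) →
  independent-true (delete k M) S' iS' (dependency (λ a → t (punchIn k a))
    (λ a e → trans (sym (insertAt-punchIn k S' a)) (t⊆ _ e)) (restricted-nonempty t t⊆ i₀ ti₀)
    (λ c → trans (sym (trans (⨁-punch k (λ i → t i ∧ M i (punchIn k c))) (cong (_xor rowComb (delete k M) (λ a → t (punchIn k a)) c)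
                                                    (cong (_∧ M k (punchIn k c)) (tk t t⊆)))))
                 (t-zero (punchIn k c)))) }
  where
  tk : ∀ t → t ⊆ vlookup (insertAt k S') → t k ≡ false
  tk t t⊆ with t k in e
  ... | false = refl
  ... | true  = ⊥-elim (false≢true (trans (sym (insertAt-self k S')) (t⊆ k e)))
  restricted-nonempty : ∀ t → t ⊆ vlookup (insertAt k S') → ∀ i₀ → t i₀ ≡ true →
    Σ (Fin m) (λ a → t (punchIn k a) ≡ true)
  restricted-nonempty t t⊆ i₀ ti₀ with punchIn-cover k i₀
  ... | inj₁ e = ⊥-elim (false≢true (trans (sym (tk t t⊆)) (subst (λ i → t i ≡ true) (==-sound i₀ k e) ti₀)))
  ... | inj₂ (a , e) = a , subst (λ i → t i ≡ true) (sym e) ti₀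

delete-restrict : ∀ {m} (M : Matrix (suc m)) k → (∀ a → M a k ≡ false) → ∀ S → independent M S ≡ true →
  independent (delete k M) (fromFun (λ a → vlookup S (punchIn k a))) ≡ true
delete-restrict {m} M k col-zero S iS = independent-intro (delete k M) _ λ { (dependency t' t'⊆ (a₀ , t'a₀) t'-zero) →
  independent-true M S iS (dependency (lift t') (lift⊆ t' t'⊆) (punchIn k a₀ , trans (lift-punchIn t' a₀) t'a₀)
                                     (lift-zero t' t'-zero)) }
  where
  lift : (Fin m → Bool) → Fin (suc m) → Bool
  lift t' = vlookup (insertAt k (fromFun t'))
  lift-punchIn : ∀ t' a → lift t' (punchIn k a) ≡ t' a
  lift-punchIn t' a = trans (insertAt-punchIn k (fromFun t') a) (vlookup-fromFun t' a)
  lift⊆ : ∀ t' → t' ⊆ vlookup (fromFun (λ a → vlookup S (punchIn k a))) → lift t' ⊆ vlookup S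
  lift⊆ t' t'⊆ i ti with punchIn-cover k i
  ... | inj₁ e = ⊥-elim (false≢true (trans (sym (insertAt-self k (fromFun t')))
                                          (subst (λ j → lift t' j ≡ true) (==-sound i k e) ti)))
  ... | inj₂ (a , refl) = trans (sym (vlookup-fromFun (λ a → vlookup S (punchIn k a)) a))
                                (t'⊆ a (trans (sym (lift-punchIn t' a)) ti))
  lift-zero : ∀ t' → (∀ c → rowComb (delete k M) t' c ≡ false) → ∀ c → rowComb M (lift t') c ≡ false
  lift-zero t' t'-zero c with punchIn-cover k c
  ... | inj₁ e rewrite ==-sound c k e = ⨁-zero _ (λ i → trans (cong (lift t' i ∧_) (col-zero i)) (∧-zeroʳ _))
  ... | inj₂ (c' , refl) = begin
    rowComb M (lift t') (punchIn k c')
      ≡⟨ ⨁-punch k (λ i → lift t' i ∧ M i (punchIn k c')) ⟩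
    (lift t' k ∧ M k (punchIn k c')) xor ⨁ (λ a → lift t' (punchIn k a) ∧ M (punchIn k a) (punchIn k c'))
      ≡⟨ cong₂ _xor_ (cong (_∧ M k (punchIn k c')) (insertAt-self k (fromFun t')))
                     (⨁-ext _ _ (λ a → cong (_∧ delete k M a c') (lift-punchIn t' a))) ⟩
    rowComb (delete k M) t' c'
      ≡⟨ t'-zero c' ⟩
    false ∎
    where open ≡-Reasoning

delete-rank : ∀ {m} (M : Matrix (suc m)) k → (∀ c → M k c ≡ false) → (∀ a → M a k ≡ false) →
  rank M ≡ rank (delete k M)
delete-rank {m} M k row-zero col-zero = rank-char M _ lower upper
  where
  lower : Σ (Vec Bool (suc m)) (λ S → (independent M S ≡ true) × (rank (delete k M) ≤ card S))
  lower with rank-attained (delete k M)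
  ... | S' , iS' , cS' = insertAt k S' , delete-extend M k S' iS' ,
        subst (_≤ card (insertAt k S')) (trans (card-insertAt k S') cS') ≤-refl
  upper : ∀ S → independent M S ≡ true → card S ≤ rank (delete k M)
  upper S iS = subst (_≤ rank (delete k M)) (sym card-S) (rank-upper (delete k M) _ (delete-restrict M k col-zero S iS))
    where
    card-S : card S ≡ card (fromFun (λ a → vlookup S (punchIn k a)))
    card-S = card-punch k S (zero-row-excluded M k row-zero S iS)

-- Eliminating a hyperbolic pair.  If rows/columns p ≠ q of M carry the block
-- (0 1 / 1 0) on the diagonal, two pivots remove them and leave the Schur
-- complement with entries M a b + M a q M p b + M a p M q b.

schur : ∀ {m} → Matrix m → Fin m → Fin m → Matrix m
schur M p q a b = (M a b xor (M a q ∧ M p b)) xor (M a p ∧ M q b)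

schur-unchanged : ∀ {m} (M : Matrix m) p q a b → M p b ≡ false → M a p ≡ false → schur M p q a b ≡ M a b
schur-unchanged M p q a b Mpb Map rewrite Mpb | Map | ∧-zeroʳ (M a q) =
  trans (xor-identityʳ _) (xor-identityʳ _)

module PivotPair {m} (M : Matrix m) (p q : Fin m)
  (Mpq : M p q ≡ true) (Mqp : M q p ≡ true) (Mpp : M p p ≡ false) (Mqq : M q q ≡ false) where

  twice : Matrix m
  twice = pivot (pivot M p q) q p

  -- the zero diagonal forces p ≠ q
  p≠q : (p == q) ≡ false
  p≠q with p == q in e
  ... | false = refl
  ... | true  = ⊥-elim (false≢true (trans (sym Mpp) (subst (λ j → M p j ≡ true) (sym (==-sound p q e)) Mpq)))

  q≠p : (q == p) ≡ false
  q≠p with q == p in e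
  ... | false = refl
  ... | true  = ⊥-elim (false≢true (trans (sym Mqq) (subst (λ j → M q j ≡ true) (sym (==-sound q p e)) Mqp)))

  twice-rank : rank M ≡ suc (suc (rank twice))
  twice-rank = trans (pivot-rank M p q Mpq) (cong suc (pivot-rank (pivot M p q) q p second-pivot))
    where
    second-pivot : pivot M p q q p ≡ true
    second-pivot rewrite pivot-entry M p q q p q≠p p≠q | Mpp | ∧-zeroʳ (M q q) = trans (xor-identityʳ _) Mqp

  twice-row-p : ∀ b → twice p b ≡ false
  twice-row-p b with ==-cases b p
  ... | inj₁ eb = subst (λ j → twice p j ≡ false) (sym (==-sound b p eb)) (pivot-col-q (pivot M p q) q p p)
  ... | inj₂ eb rewrite pivot-entry (pivot M p q) q p p b p≠q eb
                      | pivot-row-p M p q b | pivot-row-p M p q p = refl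

  twice-row-q : ∀ b → twice q b ≡ false
  twice-row-q = pivot-row-p (pivot M p q) q p

  twice-col-p : ∀ a → twice a p ≡ false
  twice-col-p a = pivot-col-q (pivot M p q) q p a

  twice-col-q : ∀ a → twice a q ≡ false
  twice-col-q a with ==-cases a q
  ... | inj₁ ea = subst (λ i → twice i q ≡ false) (sym (==-sound a q ea)) (pivot-row-p (pivot M p q) q p q)
  ... | inj₂ ea rewrite pivot-entry (pivot M p q) q p a q ea q≠p
                      | pivot-col-q M p q a | pivot-col-q M p q q | ∧-zeroʳ (pivot M p q a p) = refl

  twice-entry : ∀ a b → (a == p) ≡ false → (a == q) ≡ false → (b == p) ≡ false → (b == q) ≡ false →
    twice a b ≡ schur M p q a b
  twice-entry a b ap aq bp bq
    rewrite pivot-entry (pivot M p q) q p a b aq bp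
          | pivot-entry M p q a b ap bq
          | pivot-entry M p q a p ap p≠q
          | pivot-entry M p q q b q≠p bq
          | Mpp | Mqq | ∧-zeroʳ (M a q) | xor-identityʳ (M a p) | xor-identityʳ (M q b) = refl

eliminate-pair : ∀ {m} (M : Matrix (suc (suc m))) p l (N : Matrix m) → let q = punchIn p l in
  M p q ≡ true → M q p ≡ true → M p p ≡ false → M q q ≡ false →
  (∀ a b → schur M p q (punchIn p (punchIn l a)) (punchIn p (punchIn l b)) ≡ N a b) →
  rank M ≡ suc (suc (rank N))
eliminate-pair M p l N Mpq Mqp Mpp Mqq entries = begin
  rank M                                  ≡⟨ twice-rank ⟩
  suc (suc (rank twice))                  ≡⟨ cong (suc ∘ suc) (delete-rank twice p twice-row-p twice-col-p) ⟩
  suc (suc (rank (delete p twice)))       ≡⟨ cong (suc ∘ suc) (delete-rank (delete p twice) l twice-row-q' twice-col-q') ⟩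
  suc (suc (rank (delete l (delete p twice)))) ≡⟨ cong (suc ∘ suc) (rank-ext _ _ remaining) ⟩
  suc (suc (rank N))                      ∎
  where
  open ≡-Reasoning
  open PivotPair M p (punchIn p l) Mpq Mqp Mpp Mqq
  twice-row-q' : ∀ c → delete p twice l c ≡ false
  twice-row-q' c = twice-row-q (punchIn p c)
  twice-col-q' : ∀ a → delete p twice a l ≡ false
  twice-col-q' a = twice-col-q (punchIn p a)
  off-p : ∀ a → (punchIn p (punchIn l a) == p) ≡ false
  off-p a = punchIn-==-pivot p (punchIn l a)
  off-q : ∀ a → (punchIn p (punchIn l a) == punchIn p l) ≡ false
  off-q a = trans (punchIn-==-punchIn p (punchIn l a) l) (punchIn-==-pivot l a)
  remaining : ∀ a b → delete l (delete p twice) a b ≡ N a b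
  remaining a b = trans (twice-entry _ _ (off-p a) (off-q a) (off-p b) (off-q b)) (entries a b)

suc³ : ∀ {m} → Fin m → Fin (suc (suc (suc m)))
suc³ a = Fin.suc (Fin.suc (Fin.suc a))

-- y₁ = z₁ = 0: index 1 is isolated and can be dropped.
border-rank-00 : ∀ k (Y : Vec Bool k) (Z : Vec Bool (suc k)) →
  rank (borderMatrix (suc k) (false ∷ Y) (false ∷ Z)) ≡ rank (borderMatrix k Y Z)
border-rank-00 k Y Z = trans (delete-rank B 1F row₁ col₁) (rank-ext _ _ rest)
  where
  B = borderMatrix (suc k) (false ∷ Y) (false ∷ Z)
  row₁ : ∀ c → B 1F c ≡ false
  row₁ 0F          = refl
  row₁ (Fin.suc b) = if-eta (toℕ b ≡ᵇ 1)
  col₁ : ∀ a → B a 1F ≡ false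
  col₁ 0F          = refl
  col₁ (Fin.suc a) = if-eta (toℕ a ≡ᵇ 1)
  rest : ∀ a b → delete 1F B a b ≡ borderMatrix k Y Z a b
  rest 0F          0F          = refl
  rest 0F          (Fin.suc b) = refl
  rest (Fin.suc a) 0F          = refl
  rest (Fin.suc a) (Fin.suc b) = refl

-- y₁ = 0, z₁ = 1: indices 1 and 0 form a hyperbolic pair, and what remains is
-- the tridiagonal part on indices 2, 3, …, independently of the border.
border-rank-01 : ∀ k (Y : Vec Bool k) (Z : Vec Bool (suc k)) →
  rank (borderMatrix (suc k) (false ∷ Y) (true ∷ Z)) ≡ suc (suc (rank (triMatrix k Y)))
border-rank-01 k Y Z = eliminate-pair B 1F 0F (triMatrix k Y) refl refl refl refl
  (λ a b → schur-unchanged B 1F 0F (Fin.suc (Fin.suc a)) (Fin.suc (Fin.suc b)) (if-eta (toℕ b ≡ᵇ 0)) (if-eta (toℕ a ≡ᵇ 0)))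
  where B = borderMatrix (suc k) (false ∷ Y) (true ∷ Z)

-- y₁ = 1, z₁ = 0: indices 1 and 2 form a hyperbolic pair whose removal leaves
-- the bordered matrix of (y₃, …) and (z₃, …).
border-rank-10 : ∀ k (Y : Vec Bool k) y₂ z₂ (W : Vec Bool (suc k)) →
  rank (borderMatrix (suc (suc k)) (true ∷ y₂ ∷ Y) (false ∷ z₂ ∷ W)) ≡ suc (suc (rank (borderMatrix k Y W)))
border-rank-10 k Y y₂ z₂ W = eliminate-pair B 1F 1F (borderMatrix k Y W) refl refl refl refl entries
  where
  B = borderMatrix (suc (suc k)) (true ∷ y₂ ∷ Y) (false ∷ z₂ ∷ W)
  entries : ∀ a b → schur B 1F 2F (punchIn 1F (punchIn 1F a)) (punchIn 1F (punchIn 1F b)) ≡ borderMatrix k Y W a b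
  entries 0F          0F          = schur-unchanged B 1F 2F 0F        0F        refl refl
  entries 0F          (Fin.suc b) = schur-unchanged B 1F 2F 0F        (suc³ b)  refl refl
  entries (Fin.suc a) 0F          = schur-unchanged B 1F 2F (suc³ a)  0F        refl refl
  entries (Fin.suc a) (Fin.suc b) = schur-unchanged B 1F 2F (suc³ a)  (suc³ b)  refl refl

-- y₁ = 1, z₁ = 1: the same pair, but now the Schur complement changes the
-- border entry z₃ into z₃ + y₂.
border-rank-11 : ∀ k (Y : Vec Bool k) y₂ z₂ z₃ (Z : Vec Bool k) →
  rank (borderMatrix (suc (suc k)) (true ∷ y₂ ∷ Y) (true ∷ z₂ ∷ z₃ ∷ Z))
    ≡ suc (suc (rank (borderMatrix k Y ((z₃ xor y₂) ∷ Z))))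
border-rank-11 k Y y₂ z₂ z₃ Z = eliminate-pair B 1F 1F (borderMatrix k Y ((z₃ xor y₂) ∷ Z)) refl refl refl refl entries
  where
  B = borderMatrix (suc (suc k)) (true ∷ y₂ ∷ Y) (true ∷ z₂ ∷ z₃ ∷ Z)
  entries : ∀ a b → schur B 1F 2F (punchIn 1F (punchIn 1F a)) (punchIn 1F (punchIn 1F b))
                  ≡ borderMatrix k Y ((z₃ xor y₂) ∷ Z) a b
  entries 0F 0F rewrite ∧-identityʳ z₂ = xor-same z₂
  entries 0F 1F rewrite ∧-zeroʳ z₂ = cong (_xor y₂) (xor-identityʳ z₃)
  entries 0F (Fin.suc (Fin.suc b)) rewrite ∧-zeroʳ z₂ = trans (xor-identityʳ _) (xor-identityʳ _)
  entries 1F 0F rewrite ∧-identityʳ y₂ = xor-identityʳ _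
  entries (Fin.suc (Fin.suc a)) 0F = trans (xor-identityʳ _) (xor-identityʳ _)
  entries (Fin.suc a) (Fin.suc b) = schur-unchanged B 1F 2F (suc³ a) (suc³ b) refl refl

-- Counting.  Sums over GF(2)^k, split along the first coordinate.

ΣVec : (k : ℕ) → (Vec Bool k → ℕ) → ℕ
ΣVec zero    f = f []
ΣVec (suc k) f = ΣVec k (λ v → f (false ∷ v)) + ΣVec k (λ v → f (true ∷ v))

ΣVec-ext : ∀ k (f g : Vec Bool k → ℕ) → (∀ v → f v ≡ g v) → ΣVec k f ≡ ΣVec k g
ΣVec-ext zero    f g e = e []
ΣVec-ext (suc k) f g e = cong₂ _+_ (ΣVec-ext k _ _ (λ v → e (false ∷ v))) (ΣVec-ext k _ _ (λ v → e (true ∷ v)))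

ΣVec-+ : ∀ k (f g : Vec Bool k → ℕ) → ΣVec k (λ v → f v + g v) ≡ ΣVec k f + ΣVec k g
ΣVec-+ zero    f g = refl
ΣVec-+ (suc k) f g = trans (cong₂ _+_ (ΣVec-+ k _ _) (ΣVec-+ k _ _))
  (+-interchange (ΣVec k (λ v → f (false ∷ v))) (ΣVec k (λ v → g (false ∷ v)))
                 (ΣVec k (λ v → f (true ∷ v)))  (ΣVec k (λ v → g (true ∷ v))))
  where
  +-interchange : ∀ a b c d → (a + b) + (c + d) ≡ (a + c) + (b + d)
  +-interchange = solve-∀

ΣVec-scale : ∀ k c (f : Vec Bool k → ℕ) → ΣVec k (λ v → c * f v) ≡ c * ΣVec k f
ΣVec-scale zero    c f = refl
ΣVec-scale (suc k) c f = trans (cong₂ _+_ (ΣVec-scale k c _) (ΣVec-scale k c _)) (sym (*-distribˡ-+ c _ _))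

ΣVec-const : ∀ k c → ΣVec k (λ _ → c) ≡ 2 ^ k * c
ΣVec-const zero    c = sym (+-identityʳ c)
ΣVec-const (suc k) c = begin
  ΣVec k (λ _ → c) + ΣVec k (λ _ → c)  ≡⟨ cong₂ _+_ (ΣVec-const k c) (ΣVec-const k c) ⟩
  2 ^ k * c + 2 ^ k * c                ≡⟨ doubling (2 ^ k) c ⟩
  2 * 2 ^ k * c                        ∎
  where
  open ≡-Reasoning
  doubling : ∀ x c → x * c + x * c ≡ 2 * x * c
  doubling = solve-∀

ΣVec-zero : ∀ k (f : Vec Bool k → ℕ) → (∀ v → f v ≡ 0) → ΣVec k f ≡ 0
ΣVec-zero k f e = trans (ΣVec-ext k f (λ _ → 0) e) (trans (ΣVec-const k 0) (*-zeroʳ (2 ^ k)))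

-- Translating the first coordinate by b permutes GF(2)^(k+1), so sums are invariant.
xorHead : ∀ {k} → Bool → Vec Bool (suc k) → Vec Bool (suc k)
xorHead b (x ∷ v) = (x xor b) ∷ v

ΣVec-xorHead : ∀ k b (f : Vec Bool (suc k) → ℕ) → ΣVec (suc k) (λ v → f (xorHead b v)) ≡ ΣVec (suc k) f
ΣVec-xorHead k false f = refl
ΣVec-xorHead k true  f = +-comm (ΣVec k (λ v → f (true ∷ v))) _

sumOver : ∀ {A : Set} → (A → ℕ) → List A → ℕ
sumOver f []       = 0
sumOver f (x ∷ xs) = f x + sumOver f xs

count-sumOver : ∀ {A : Set} (p : A → Bool) xs → count p xs ≡ sumOver (λ x → bit (p x)) xs
count-sumOver p []       = refl
count-sumOver p (x ∷ xs) with p x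
... | true  = cong suc (count-sumOver p xs)
... | false = count-sumOver p xs

sumOver-++ : ∀ {A : Set} (f : A → ℕ) xs ys → sumOver f (xs ++ ys) ≡ sumOver f xs + sumOver f ys
sumOver-++ f []       ys = refl
sumOver-++ f (x ∷ xs) ys = trans (cong (f x +_) (sumOver-++ f xs ys)) (sym (+-assoc (f x) _ _))

sumOver-ext : ∀ {A : Set} (f g : A → ℕ) xs → (∀ x → f x ≡ g x) → sumOver f xs ≡ sumOver g xs
sumOver-ext f g []       e = refl
sumOver-ext f g (x ∷ xs) e = cong₂ _+_ (e x) (sumOver-ext f g xs e)

sumOver-cartesianProduct : ∀ {A B : Set} (f : A × B → ℕ) xs ys →
  sumOver f (cartesianProduct xs ys) ≡ sumOver (λ x → sumOver (λ y → f (x , y)) ys) xs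
sumOver-cartesianProduct f []       ys = refl
sumOver-cartesianProduct f (x ∷ xs) ys =
  trans (sumOver-++ f (map (x ,_) ys) (cartesianProduct xs ys))
        (cong₂ _+_ (sumOver-map ys) (sumOver-cartesianProduct f xs ys))
  where
  sumOver-map : ∀ ys → sumOver f (map (x ,_) ys) ≡ sumOver (λ y → f (x , y)) ys
  sumOver-map []       = refl
  sumOver-map (y ∷ ys) = cong (f (x , y) +_) (sumOver-map ys)

sumOver-allVecs : ∀ k (f : Vec Bool k → ℕ) → sumOver f (allVecs k) ≡ ΣVec k f
sumOver-allVecs zero    f = +-identityʳ (f [])
sumOver-allVecs (suc k) f = begin
  sumOver f (allVecs (suc k))
    ≡⟨ doubling (allVecs k) ⟩
  sumOver (λ v → f (false ∷ v) + f (true ∷ v)) (allVecs k)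
    ≡⟨ sumOver-allVecs k _ ⟩
  ΣVec k (λ v → f (false ∷ v) + f (true ∷ v))
    ≡⟨ ΣVec-+ k _ _ ⟩
  ΣVec (suc k) f ∎
  where
  open ≡-Reasoning
  doubling : ∀ vs → sumOver f (concatMap (λ v → (false ∷ v) ∷ (true ∷ v) ∷ []) vs)
                  ≡ sumOver (λ v → f (false ∷ v) + f (true ∷ v)) vs
  doubling []       = refl
  doubling (v ∷ vs) = trans (cong (f (false ∷ v) +_) (cong (f (true ∷ v) +_) (doubling vs)))
                            (sym (+-assoc (f (false ∷ v)) (f (true ∷ v)) _))

hits : ℕ → ℕ → ℕ
hits j r = bit (r ≡ᵇ j)

𝒫-sum : ∀ k j → 𝒫 (suc (suc k)) j ≡ ΣVec k (λ Y → ΣVec (suc k) (λ Z → hits j (rank (borderMatrix k Y Z))))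
𝒫-sum k j = begin
  𝒫 (suc (suc k)) j
    ≡⟨ count-sumOver _ (cartesianProduct (allVecs k) (allVecs (suc k))) ⟩
  sumOver (λ YZ → hits j (rank (borderMatrix k (proj₁ YZ) (proj₂ YZ)))) (cartesianProduct (allVecs k) (allVecs (suc k)))
    ≡⟨ sumOver-cartesianProduct _ (allVecs k) (allVecs (suc k)) ⟩
  sumOver (λ Y → sumOver (λ Z → hits j (rank (borderMatrix k Y Z))) (allVecs (suc k))) (allVecs k)
    ≡⟨ sumOver-ext _ _ (allVecs k) (λ Y → sumOver-allVecs (suc k) _) ⟩
  sumOver (λ Y → ΣVec (suc k) (λ Z → hits j (rank (borderMatrix k Y Z)))) (allVecs k)
    ≡⟨ sumOver-allVecs k _ ⟩
  ΣVec k (λ Y → ΣVec (suc k) (λ Z → hits j (rank (borderMatrix k Y Z)))) ∎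
  where open ≡-Reasoning

𝒪-sum : ∀ k j → 𝒪 (suc k) j ≡ ΣVec k (λ Y → hits j (rank (triMatrix k Y)))
𝒪-sum k j = trans (count-sumOver _ (allVecs k)) (sumOver-allVecs k _)

z²·𝒫-sum : ∀ k j → ΣVec k (λ Y → ΣVec (suc k) (λ Z → hits j (suc (suc (rank (borderMatrix k Y Z))))))
                  ≡ z²· (𝒫 (suc (suc k))) j
z²·𝒫-sum k zero          = ΣVec-zero k _ (λ Y → ΣVec-zero (suc k) _ (λ Z → refl))
z²·𝒫-sum k (suc zero)    = ΣVec-zero k _ (λ Y → ΣVec-zero (suc k) _ (λ Z → refl))
z²·𝒫-sum k (suc (suc j)) = sym (𝒫-sum k j)

z²·𝒪-sum : ∀ k j → ΣVec k (λ Y → hits j (suc (suc (rank (triMatrix k Y))))) ≡ z²· (𝒪 (suc k)) j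
z²·𝒪-sum k zero          = ΣVec-zero k _ (λ Y → refl)
z²·𝒪-sum k (suc zero)    = ΣVec-zero k _ (λ Y → refl)
z²·𝒪-sum k (suc (suc j)) = sym (𝒪-sum k j)

-- The recurrence for n = k + 3, writing K = n - 1: the pairs (Y, Z) counted by
-- 𝒫_{n+1} are split according to their first link y₁ and border entry z₁.
module Recurrence (k j : ℕ) where

  K : ℕ
  K = suc (suc k)

  part : Bool → Bool → Vec Bool (suc k) → ℕ
  part y z Y = ΣVec K (λ Z → hits j (rank (borderMatrix K (y ∷ Y) (z ∷ Z))))

  Q : Vec Bool k → ℕ
  Q Y = ΣVec (suc k) (λ W → hits j (suc (suc (rank (borderMatrix k Y W)))))

  part-00 : ΣVec (suc k) (part false false) ≡ 𝒫 (suc K) j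
  part-00 = trans (ΣVec-ext (suc k) _ _ (λ Y → ΣVec-ext K _ _ (λ Z → cong (hits j) (border-rank-00 (suc k) Y Z))))
                  (sym (𝒫-sum (suc k) j))

  part-01 : ΣVec (suc k) (part false true) ≡ 2 ^ K * z²· (𝒪 K) j
  part-01 = begin
    ΣVec (suc k) (part false true)
      ≡⟨ ΣVec-ext (suc k) _ _ (λ Y → trans (ΣVec-ext K _ _ (λ Z → cong (hits j) (border-rank-01 (suc k) Y Z)))
                                          (ΣVec-const K _)) ⟩
    ΣVec (suc k) (λ Y → 2 ^ K * hits j (suc (suc (rank (triMatrix (suc k) Y)))))
      ≡⟨ ΣVec-scale (suc k) (2 ^ K) (λ Y → hits j (suc (suc (rank (triMatrix (suc k) Y))))) ⟩
    2 ^ K * ΣVec (suc k) (λ Y → hits j (suc (suc (rank (triMatrix (suc k) Y)))))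
      ≡⟨ cong (2 ^ K *_) (z²·𝒪-sum (suc k) j) ⟩
    2 ^ K * z²· (𝒪 K) j ∎
    where open ≡-Reasoning

  -- With y₁ = 1 the count does not depend on (y₂, z₂), giving four copies of z² 𝒫_K.
  four-copies : ∀ z →
    (∀ y₂ z₂ Y → ΣVec (suc k) (λ W → hits j (rank (borderMatrix K (true ∷ y₂ ∷ Y) (z ∷ z₂ ∷ W)))) ≡ Q Y) →
    ΣVec (suc k) (part true z) ≡ 4 * z²· (𝒫 K) j
  four-copies z independent-of-y₂z₂ = begin
    ΣVec (suc k) (part true z)
      ≡⟨ cong₂ _+_ (ΣVec-ext k _ _ (λ Y → cong₂ _+_ (independent-of-y₂z₂ false false Y) (independent-of-y₂z₂ false true Y)))
                   (ΣVec-ext k _ _ (λ Y → cong₂ _+_ (independent-of-y₂z₂ true false Y) (independent-of-y₂z₂ true true Y))) ⟩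
    ΣVec k (λ Y → Q Y + Q Y) + ΣVec k (λ Y → Q Y + Q Y)
      ≡⟨ cong₂ _+_ (ΣVec-+ k Q Q) (ΣVec-+ k Q Q) ⟩
    (ΣVec k Q + ΣVec k Q) + (ΣVec k Q + ΣVec k Q)
      ≡⟨ quadruple (ΣVec k Q) ⟩
    4 * ΣVec k Q
      ≡⟨ cong (4 *_) (z²·𝒫-sum k j) ⟩
    4 * z²· (𝒫 K) j ∎
    where
    open ≡-Reasoning
    quadruple : ∀ x → (x + x) + (x + x) ≡ 4 * x
    quadruple = solve-∀

  part-10 : ΣVec (suc k) (part true false) ≡ 4 * z²· (𝒫 K) j
  part-10 = four-copies false λ y₂ z₂ Y → ΣVec-ext (suc k) _ _ (λ W → cong (hits j) (border-rank-10 k Y y₂ z₂ W))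

  -- here the sum over z₃ absorbs the translation z₃ ↦ z₃ + y₂
  part-11 : ΣVec (suc k) (part true true) ≡ 4 * z²· (𝒫 K) j
  part-11 = four-copies true λ y₂ z₂ Y →
    let f = λ W → hits j (suc (suc (rank (borderMatrix k Y W)))) in
    trans (ΣVec-ext (suc k) (λ W → hits j (rank (borderMatrix K (true ∷ y₂ ∷ Y) (true ∷ z₂ ∷ W))))
                            (λ W → f (xorHead y₂ W))
                            (λ { (z₃ ∷ Z) → cong (hits j) (border-rank-11 k Y y₂ z₂ z₃ Z) }))
          (ΣVec-xorHead k y₂ f)

  step : 𝒫 (suc (suc K)) j ≡ (𝒫 (suc K) j + 8 * z²· (𝒫 K) j) + 2 ^ K * z²· (𝒪 K) j
  step = begin
    𝒫 (suc (suc K)) j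
      ≡⟨ 𝒫-sum K j ⟩
    ΣVec (suc k) (λ Y → part false false Y + part false true Y) + ΣVec (suc k) (λ Y → part true false Y + part true true Y)
      ≡⟨ cong₂ _+_ (ΣVec-+ (suc k) (part false false) (part false true)) (ΣVec-+ (suc k) (part true false) (part true true)) ⟩
    (ΣVec (suc k) (part false false) + ΣVec (suc k) (part false true))
      + (ΣVec (suc k) (part true false) + ΣVec (suc k) (part true true))
      ≡⟨ cong₂ _+_ (cong₂ _+_ part-00 part-01) (cong₂ _+_ part-10 part-11) ⟩
    (𝒫 (suc K) j + 2 ^ K * z²· (𝒪 K) j) + (4 * z²· (𝒫 K) j + 4 * z²· (𝒫 K) j)
      ≡⟨ regroup (𝒫 (suc K) j) (2 ^ K * z²· (𝒪 K) j) (z²· (𝒫 K) j) ⟩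
    (𝒫 (suc K) j + 8 * z²· (𝒫 K) j) + 2 ^ K * z²· (𝒪 K) j ∎
    where
    open ≡-Reasoning
    regroup : ∀ p o x → (p + o) + (4 * x + 4 * x) ≡ (p + 8 * x) + o
    regroup = solve-∀

recurrence : (n : ℕ) → 3 ≤ n → (j : ℕ) →
  𝒫 (suc n) j ≡ (𝒫 n ⊕ 8 · z²· (𝒫 (n ∸ 1)) ⊕ (2 ^ (n ∸ 1)) · z²· (𝒪 (n ∸ 1))) j
recurrence (suc (suc (suc k))) (s≤s (s≤s (s≤s z≤n))) j = Recurrence.step k j

𝒫₂ : (j : ℕ) → 𝒫 2 j ≡ fromCoeffs (1 ∷ 0 ∷ 1 ∷ []) j
𝒫₂ 0 = refl
𝒫₂ 1 = refl
𝒫₂ 2 = refl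
𝒫₂ (suc (suc (suc j))) = refl

𝒫₃ : (j : ℕ) → 𝒫 3 j ≡ fromCoeffs (1 ∷ 0 ∷ 7 ∷ []) j
𝒫₃ 0 = refl
𝒫₃ 1 = refl
𝒫₃ 2 = refl
𝒫₃ (suc (suc (suc j))) = refl

𝒫₄ : (j : ℕ) → 𝒫 4 j ≡ fromCoeffs (1 ∷ 0 ∷ 19 ∷ 0 ∷ 12 ∷ []) j
𝒫₄ 0 = refl
𝒫₄ 1 = refl
𝒫₄ 2 = refl
𝒫₄ 3 = refl
𝒫₄ 4 = refl
𝒫₄ (suc (suc (suc (suc (suc j))))) = refl

mainTheorem4 : ((n : ℕ) → 3 ≤ n → (j : ℕ) →
                  𝒫 (suc n) j ≡ (𝒫 n ⊕ 8 · z²· (𝒫 (n ∸ 1)) ⊕ (2 ^ (n ∸ 1)) · z²· (𝒪 (n ∸ 1))) j)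
               × ((j : ℕ) → 𝒫 2 j ≡ fromCoeffs (1 ∷ 0 ∷ 1 ∷ []) j)
               × ((j : ℕ) → 𝒫 3 j ≡ fromCoeffs (1 ∷ 0 ∷ 7 ∷ []) j)
               × ((j : ℕ) → 𝒫 4 j ≡ fromCoeffs (1 ∷ 0 ∷ 19 ∷ 0 ∷ 12 ∷ []) j)
mainTheorem4 = recurrence , 𝒫₂ , 𝒫₃ , 𝒫₄
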